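{- Let $m\ge 4$ and let $K_m$ be the complete graph on $\{x_1,\dots,x_m\}$. Then the complement $\overline{K_m\square K_m}$ of the Cartesian product $K_m\square K_m$ (the graph on $\{x_1,\dots,x_m\}^2$ in which $(x_i,x_j)$ and $(x_k,x_l)$ are adjacent iff $i\ne k$ and $j\ne l$) is special.
   Context: A vertex set $S$ dominates a graph $H$ if every vertex of $H$ is in $S$ or adjacent to a vertex of $S$; an edge dominates $H$ if the set of its two endpoints does. A graph $H$ is special if: (1) $H$ has diameter two; (2) $H$ has no dominating edge; (3) $H$ has two vertices $u,v$ (a special pair) such that (a) the distance between $u$ and $v$ is two, (b) neither $H-u$ nor $H-v$ has a dominating edge, and (c) $(N(u)\cap N(v))\cup\{u,v\}$ is a dominating set of $H$. Here $N(x)$ is the set of neighbors of $x$. -}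

module Defs where

open import Level using (Level; _⊔_; suc)
open import Data.Nat using (ℕ)
open import Data.Fin using (Fin)
open import Data.Product using (Σ; ∃; ∃-syntax; _×_; _,_)
open import Data.Sum using (_⊎_)
open import Relation.Nullary using (¬_)
open import Relation.Binary.PropositionalEquality using (_≡_)

record Graph : Set₁ where
  field
    V     : Set
    Adj   : V → V → Set
    sym   : ∀ {x y} → Adj x y → Adj y x
    irrefl : ∀ {x} → ¬ Adj x x

module _ (H : Graph) where
  open Graph H

  CommonNbr : V → V → V → Set
  CommonNbr x y w = Adj x w × Adj y w

  DistLe2 : V → V → Set
  DistLe2 x y = x ≡ y ⊎ Adj x y ⊎ ∃[ w ] CommonNbr x y w

  Dist2 : V → V → Set
  Dist2 x y = ¬ x ≡ y × ¬ Adj x y × ∃[ w ] CommonNbr x y w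

  Diameter2 : Set
  Diameter2 = (∀ x y → DistLe2 x y) × ∃[ x ] ∃[ y ] Dist2 x y

  Dominates : (V → Set) → Set
  Dominates S = ∀ w → S w ⊎ ∃[ s ] (S s × Adj s w)

  EdgeDominates : V → V → Set
  EdgeDominates a b = ∀ w → (w ≡ a ⊎ w ≡ b) ⊎ (Adj a w ⊎ Adj b w)

  HasDominatingEdge : Set
  HasDominatingEdge = ∃[ a ] ∃[ b ] (Adj a b × EdgeDominates a b)

  -- H - u has a dominating edge: an edge ab of H avoiding u, dominating
  -- every vertex other than u (H - u is the induced subgraph on V ∖ {u})
  HasDominatingEdgeMinus : V → Set
  HasDominatingEdgeMinus u =
    ∃[ a ] ∃[ b ] (¬ a ≡ u × ¬ b ≡ u × Adj a b ×
      (∀ w → ¬ w ≡ u → (w ≡ a ⊎ w ≡ b) ⊎ (Adj a w ⊎ Adj b w)))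

  SpecialPair : V → V → Set
  SpecialPair u v =
    Dist2 u v ×
    ¬ HasDominatingEdgeMinus u ×
    ¬ HasDominatingEdgeMinus v ×
    Dominates (λ x → CommonNbr u v x ⊎ (x ≡ u ⊎ x ≡ v))

  Special : Set
  Special = Diameter2 × ¬ HasDominatingEdge × ∃[ u ] ∃[ v ] SpecialPair u v

compKmKm : ℕ → Graph
compKmKm m = record
  { V = Fin m × Fin m
  ; Adj = λ { (i , j) (k , l) → ¬ i ≡ k × ¬ j ≡ l }
  ; sym = λ { (p , q) → (λ e → p (Eq.sym e)) , (λ e → q (Eq.sym e)) }
  ; irrefl = λ { (p , _) → p Eq.refl }
  }
  where import Relation.Binary.PropositionalEquality as Eq

module Submission where

-- The key observation is about corners: for an edge a = (i , j), b = (k , l)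
-- the vertex corner a b = (i , l) shares a row with a and a column with b and
-- differs from both, so the edge {a , b} does not dominate it.  Hence H has
-- no dominating edge.  The two corners (i , l) and (k , j) are distinct, so
-- at most one of them can be a deleted vertex u, and H - u has no
-- dominating edge either; this holds for every m and every u.
--
-- Diameter two needs m ≥ 3: any two vertices have a common neighbour, found
-- by avoiding two rows and two columns.  For the special pair we take
-- u = (0 , 0), v = (0 , 1): their common neighbours are the vertices outside
-- row 0 and columns 0, 1, and for m ≥ 4 these together with u and v dominate H.

open import Defs
open import Data.Nat using (ℕ; _+_; _≤_; s≤s)
open import Data.Fin using (Fin; zero; suc)
open import Data.Fin.Properties using (_≟_; suc-injective)
open import Data.Product using (∃-syntax; _×_; _,_; proj₁; proj₂)
open import Data.Product.Properties using (≡-dec)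
open import Data.Sum using (_⊎_; inj₁; inj₂)
open import Function using (_∘_)
open import Relation.Nullary using (¬_; yes; no)
open import Relation.Binary.PropositionalEquality using (_≡_; _≢_; refl; sym; trans; cong)

other : ∀ {n} (x : Fin (2 + n)) → ∃[ z ] z ≢ x
other zero    = suc zero , λ ()
other (suc x) = zero , λ ()

avoid2 : ∀ {n} (x y : Fin (3 + n)) → ∃[ z ] (z ≢ x × z ≢ y)
avoid2 zero zero = suc zero , (λ ()) , (λ ())
avoid2 zero (suc y) =
  let z , z≢y = other y in suc z , (λ ()) , z≢y ∘ suc-injective
avoid2 (suc x) zero =
  let z , z≢x = other x in suc z , z≢x ∘ suc-injective , (λ ())
avoid2 (suc x) (suc y) = zero , (λ ()) , (λ ())

module _ (H : Graph) where
  open Graph H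

  DominatedByEdge : V → V → V → Set
  DominatedByEdge a b w = (w ≡ a ⊎ w ≡ b) ⊎ (Adj a w ⊎ Adj b w)

  dominatedByEdge-swap : ∀ {a b w} → DominatedByEdge a b w → DominatedByEdge b a w
  dominatedByEdge-swap (inj₁ (inj₁ w≡a)) = inj₁ (inj₂ w≡a)
  dominatedByEdge-swap (inj₁ (inj₂ w≡b)) = inj₁ (inj₁ w≡b)
  dominatedByEdge-swap (inj₂ (inj₁ aw))  = inj₂ (inj₂ aw)
  dominatedByEdge-swap (inj₂ (inj₂ bw))  = inj₂ (inj₁ bw)

module _ {m : ℕ} where
  open Graph (compKmKm m) using (V; Adj)

  corner : V → V → V
  corner (i , _) (_ , l) = i , l

  corner-undominated : ∀ a b → Adj a b → ¬ DominatedByEdge (compKmKm m) a b (corner a b)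
  corner-undominated a b (i≢k , j≢l) (inj₁ (inj₁ c≡a)) = j≢l (sym (cong proj₂ c≡a))
  corner-undominated a b (i≢k , j≢l) (inj₁ (inj₂ c≡b)) = i≢k (cong proj₁ c≡b)
  corner-undominated a b _ (inj₂ (inj₁ (i≢i , _))) = i≢i refl
  corner-undominated a b _ (inj₂ (inj₂ (_ , l≢l))) = l≢l refl

  corners-distinct : ∀ a b → Adj a b → corner a b ≢ corner b a
  corners-distinct a b (i≢k , _) = i≢k ∘ cong proj₁

  noDominatingEdge : ¬ HasDominatingEdge (compKmKm m)
  noDominatingEdge (a , b , ab , dom) = corner-undominated a b ab (dom (corner a b))

  noDominatingEdgeMinus : ∀ u → ¬ HasDominatingEdgeMinus (compKmKm m) u
  noDominatingEdgeMinus u (a , b , _ , _ , ab , dom)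
    with ≡-dec _≟_ _≟_ (corner a b) u | ≡-dec _≟_ _≟_ (corner b a) u
  ... | no  c≢u | _        = corner-undominated a b ab (dom _ c≢u)
  ... | yes _   | no  c′≢u =
    corner-undominated b a (Graph.sym (compKmKm m) ab)
      (dominatedByEdge-swap (compKmKm m) (dom _ c′≢u))
  ... | yes c≡u | yes c′≡u = corners-distinct a b ab (trans c≡u (sym c′≡u))

module _ {n : ℕ} where
  commonNeighbour : ∀ (x y : Fin (3 + n) × Fin (3 + n)) → ∃[ w ] CommonNbr (compKmKm (3 + n)) x y w
  commonNeighbour (i , j) (k , l) with avoid2 i k | avoid2 j l
  ... | r , r≢i , r≢k | c , c≢j , c≢l =
    (r , c) , (r≢i ∘ sym , c≢j ∘ sym) , (r≢k ∘ sym , c≢l ∘ sym)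

  u₀ v₀ : Fin (3 + n) × Fin (3 + n)
  u₀ = zero , zero
  v₀ = zero , suc zero

  commonNbr-u₀v₀ : ∀ i j → CommonNbr (compKmKm (3 + n)) u₀ v₀ (suc i , suc (suc j))
  commonNbr-u₀v₀ i j = ((λ ()) , (λ ())) , ((λ ()) , (λ ()))

  dist2-u₀v₀ : Dist2 (compKmKm (3 + n)) u₀ v₀
  dist2-u₀v₀ = (λ ()) , (λ { (0≢0 , _) → 0≢0 refl }) , _ , commonNbr-u₀v₀ zero zero

  diameter2 : Diameter2 (compKmKm (3 + n))
  diameter2 = (λ x y → inj₂ (inj₂ (commonNeighbour x y))) , u₀ , v₀ , dist2-u₀v₀

-- For m ≥ 4 the common neighbours of u₀, v₀ together with u₀, v₀ dominate H;
-- the fourth column is needed for the vertices (0 , j) with j ≥ 2.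
dominating-u₀v₀ : ∀ {n} → let H = compKmKm (4 + n) in
  Dominates H (λ x → CommonNbr H u₀ v₀ x ⊎ (x ≡ u₀ ⊎ x ≡ v₀))
dominating-u₀v₀ (zero , zero)        = inj₁ (inj₂ (inj₁ refl))
dominating-u₀v₀ (zero , suc zero)    = inj₁ (inj₂ (inj₂ refl))
dominating-u₀v₀ (zero , suc (suc j)) =
  let k , k≢j = other j
  in inj₂ (_ , inj₁ (commonNbr-u₀v₀ zero k) , (λ ()) , k≢j ∘ suc-injective ∘ suc-injective)
dominating-u₀v₀ (suc i , zero)        = inj₂ (v₀ , inj₂ (inj₂ refl) , (λ ()) , (λ ()))
dominating-u₀v₀ (suc i , suc zero)    = inj₂ (u₀ , inj₂ (inj₁ refl) , (λ ()) , (λ ()))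
dominating-u₀v₀ (suc i , suc (suc j)) = inj₁ (inj₁ (commonNbr-u₀v₀ i j))

claim1 : (m : ℕ) → 4 ≤ m → Special (compKmKm m)
claim1 _ (s≤s (s≤s (s≤s (s≤s {n = n} _)))) =
    diameter2
  , noDominatingEdge
  , u₀ , v₀
  , dist2-u₀v₀
  , noDominatingEdgeMinus u₀
  , noDominatingEdgeMinus v₀
  , dominating-u₀v₀
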